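{- Let $k\ge 1$ be an integer, let $G$ be a connected graph with $n=|V(G)|$ vertices, and let $w\colon V(G)\to\mathbb{Q}_{>0}$. Let $\mathcal{P}_k(G,w)$ be the convex hull of all vectors $x\in\{0,1\}^{V(G)\times[k]}$ satisfying (a) $\sum_{v\in V(G)} w(v)\,x_{v,i}\le \sum_{v\in V(G)} w(v)\,x_{v,i+1}$ for all $i\in[k-1]$; (b) $\sum_{i\in[k]} x_{v,i}\le 1$ for all $v\in V(G)$; (c) $x_{u,i}+x_{v,i}-\sum_{z\in S}x_{z,i}\le 1$ for every pair of distinct non-adjacent vertices $u,v$ of $G$, every minimal $(u,v)$-separator $S$ of $G$, and every $i\in[k]$. Then $$\mathcal{P}_k(G,w)=\operatorname{conv}\{\xi(\mathcal{V})\colon \mathcal{V}\text{ is a connected }k\text{ -subpartition of }G\}.$$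
   Context: $[k]=\{1,\dots,k\}$. For non-adjacent vertices $u,v$ of $G$, a set $S\subseteq V(G)\setminus\{u,v\}$ is a $(u,v)$-separator if $u$ and $v$ lie in different components of $G-S$; it is minimal if no proper subset is a $(u,v)$-separator. For $V'\subseteq V(G)$, $w(V')=\sum_{v\in V'}w(v)$. A connected $k$-subpartition of $G$ is a $k$-tuple $\mathcal{V}=(V_1,\dots,V_k)$ of pairwise disjoint (possibly empty) subsets of $V(G)$ such that each nonempty $V_i$ induces a connected subgraph $G[V_i]$, and ordered so that $w(V_i)\le w(V_{i+1})$ for all $i\in[k-1]$. Its incidence vector $\xi(\mathcal{V})\in\{0,1\}^{V(G)\times[k]}$ has $\xi(\mathcal{V})_{v,i}=1$ iff $v\in V_i$.
   Formalization: The convex hulls are taken over ℚ, with rational coefficients, and the equality of the two polytopes is asserted only for points with rational coordinates. -}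

module Defs where

open import Data.Nat using (ℕ; zero; suc)
open import Data.Fin using (Fin; zero; suc; toℕ)
open import Data.Bool using (Bool; true; false; if_then_else_)
open import Data.Rational using (ℚ; 0ℚ; 1ℚ; _+_; _*_; _-_; _≤_; _<_)
open import Data.Product using (Σ; _×_; ∃)
open import Relation.Binary.PropositionalEquality using (_≡_; _≢_)
open import Relation.Nullary using (¬_)

Σℚ : ∀ {m} → (Fin m → ℚ) → ℚ
Σℚ {zero}  f = 0ℚ
Σℚ {suc m} f = f zero + Σℚ (λ j → f (suc j))

b2q : Bool → ℚ
b2q true  = 1ℚ
b2q false = 0ℚ

Subset : ℕ → Set
Subset n = Fin n → Bool

record Graph (n : ℕ) : Set where
  field
    adj     : Fin n → Fin n → Bool
    adj-sym : ∀ u v → adj u v ≡ adj v u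
    adj-irr : ∀ u → adj u u ≡ false
open Graph public

-- walks in G all of whose vertices lie in A (i.e. walks in G[A])
data Walk {n : ℕ} (G : Graph n) (A : Subset n) : Fin n → Fin n → Set where
  here : ∀ {u} → A u ≡ true → Walk G A u u
  step : ∀ {u v t} → A u ≡ true → adj G u v ≡ true → Walk G A v t → Walk G A u t

Connected : ∀ {n} → Graph n → Set
Connected {n} G = ∀ (u v : Fin n) → Walk G (λ _ → true) u v

-- G[A] connected (vacuous for empty A)
InducesConnected : ∀ {n} → Graph n → Subset n → Set
InducesConnected {n} G A = ∀ (u v : Fin n) → A u ≡ true → A v ≡ true → Walk G A u v

IsSeparator : ∀ {n} → Graph n → Fin n → Fin n → Subset n → Set
IsSeparator G u v S =
  S u ≡ false × S v ≡ false × ¬ Walk G (λ z → Data.Bool.not (S z)) u v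

ProperSubset : ∀ {n} → Subset n → Subset n → Set
ProperSubset {n} S' S = (∀ z → S' z ≡ true → S z ≡ true) × ∃ λ (z : Fin n) → S z ≡ true × S' z ≡ false

IsMinimalSeparator : ∀ {n} → Graph n → Fin n → Fin n → Subset n → Set
IsMinimalSeparator {n} G u v S =
  IsSeparator G u v S × (∀ (S' : Subset n) → ProperSubset S' S → ¬ IsSeparator G u v S')

wt : ∀ {n} → (Fin n → ℚ) → Subset n → ℚ
wt w A = Σℚ (λ v → b2q (A v) * w v)

Consecutive : ∀ {k} → Fin k → Fin k → Set
Consecutive i j = toℕ j ≡ suc (toℕ i)

QVec : ℕ → ℕ → Set
QVec n k = Fin n → Fin k → ℚ

embed : ∀ {n k} → (Fin n → Fin k → Bool) → QVec n k
embed x v i = b2q (x v i)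

Conv : ∀ {n k} → (QVec n k → Set) → QVec n k → Set
Conv {n} {k} P y =
  Σ ℕ λ m → Σ (Fin m → QVec n k) λ p → Σ (Fin m → ℚ) λ λs →
    (∀ j → P (p j)) × (∀ j → 0ℚ ≤ λs j) × Σℚ λs ≡ 1ℚ ×
    (∀ v i → y v i ≡ Σℚ (λ j → λs j * p j v i))

Feasible : ∀ {n k} → Graph n → (Fin n → ℚ) → (Fin n → Fin k → Bool) → Set
Feasible {n} {k} G w x =
  (∀ (i j : Fin k) → Consecutive i j →
      Σℚ (λ v → w v * embed x v i) ≤ Σℚ (λ v → w v * embed x v j)) ×
  (∀ (v : Fin n) → Σℚ (λ i → embed x v i) ≤ 1ℚ) ×
  (∀ (u v : Fin n) → u ≢ v → adj G u v ≡ false → ∀ (S : Subset n) →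
      IsMinimalSeparator G u v S → ∀ (i : Fin k) →
      (embed x u i + embed x v i) - Σℚ (λ z → b2q (S z) * embed x z i) ≤ 1ℚ)

Pk : ∀ {n k} → Graph n → (Fin n → ℚ) → QVec n k → Set
Pk {n} {k} G w = Conv (λ y → Σ (Fin n → Fin k → Bool) λ x →
  Feasible G w x × (∀ v i → y v i ≡ embed x v i))

IsConnSubpartition : ∀ {n k} → Graph n → (Fin n → ℚ) → (Fin k → Subset n) → Set
IsConnSubpartition {n} {k} G w V =
  (∀ (i j : Fin k) → i ≢ j → ∀ (v : Fin n) → V i v ≡ true → V j v ≡ false) ×
  (∀ (i : Fin k) → InducesConnected G (V i)) ×
  (∀ (i j : Fin k) → Consecutive i j → wt w (V i) ≤ wt w (V j))

ξ : ∀ {n k} → (Fin k → Subset n) → QVec n k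
ξ V v i = b2q (V i v)

SubpartitionPolytope : ∀ {n k} → Graph n → (Fin n → ℚ) → QVec n k → Set
SubpartitionPolytope {n} {k} G w = Conv (λ y → Σ (Fin k → Subset n) λ V →
  IsConnSubpartition G w V × (∀ v i → y v i ≡ ξ V v i))

-- Both polytopes are convex hulls, so it suffices that their generating sets coincide: a 0/1 vector
-- satisfies (a)–(c) iff its columns form a connected k-subpartition. Constraint (a) is the weight
-- ordering and (b) is disjointness. For (c): if u, v lie in a connected V_i, a u–v walk in G[V_i]
-- crosses every (u,v)-separator S, so S meets V_i and the left side of (c) is at most 1. Conversely,
-- if u, v ∈ V_i are not joined in G[V_i], the complement of V_i separates them, and a minimal
-- separator inside that complement violates (c) with left side 2 − 0.
module Submission where

open import Defs
open import Data.Nat using (ℕ; _≥_)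
open import Data.Fin using (Fin)
open import Data.Rational using (ℚ; 0ℚ; _<_)
open import Data.Product using (_×_)

open import Data.Nat as ℕ using (zero; suc; s≤s)
import Data.Nat.Properties as ℕ
open import Data.Nat.Induction using (<-wellFounded)
open import Induction.WellFounded using (Acc; acc)
open import Data.Fin using (zero; suc)
open import Data.Fin.Properties using (_≟_; any?; suc-injective)
open import Data.Bool using (Bool; true; false; not; _∧_; if_then_else_)
open import Data.Bool.Properties using (not-involutive) renaming (_≟_ to _≟ᵇ_)
open import Data.Product using (Σ; ∃; _,_)
open import Data.Sum using (_⊎_; inj₁; inj₂)
open import Data.Empty using (⊥-elim)
open import Data.Unit using (tt)
open import Data.Rational using (1ℚ; _+_; _*_; _-_; -_; _≤_; _≤?_)
import Data.Rational.Properties as ℚ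
open import Function using (_∘_; flip)
open import Relation.Nullary using (Dec; yes; no; ¬_; does; ¬?)
open import Relation.Nullary.Decidable using (_×-dec_; map′; toWitness; toWitnessFalse)
open import Relation.Binary.PropositionalEquality
  using (_≡_; _≢_; refl; sym; trans; cong; cong₂; subst; subst₂)

Σℚ-cong : ∀ {m} {f g : Fin m → ℚ} → (∀ j → f j ≡ g j) → Σℚ f ≡ Σℚ g
Σℚ-cong {zero}  f≡g = refl
Σℚ-cong {suc m} f≡g = cong₂ _+_ (f≡g zero) (Σℚ-cong (f≡g ∘ suc))

Σℚ-zero : ∀ {m} {f : Fin m → ℚ} → (∀ j → f j ≡ 0ℚ) → Σℚ f ≡ 0ℚ
Σℚ-zero {zero}  f≡0 = refl
Σℚ-zero {suc m} f≡0 = cong₂ _+_ (f≡0 zero) (Σℚ-zero (f≡0 ∘ suc))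

Σℚ-nonNeg : ∀ {m} {f : Fin m → ℚ} → (∀ j → 0ℚ ≤ f j) → 0ℚ ≤ Σℚ f
Σℚ-nonNeg {zero}  f≥0 = ℚ.≤-refl
Σℚ-nonNeg {suc m} f≥0 = ℚ.+-mono-≤ (f≥0 zero) (Σℚ-nonNeg (f≥0 ∘ suc))

x≤x+nonNeg : ∀ {x y} → 0ℚ ≤ y → x ≤ x + y
x≤x+nonNeg {x} y≥0 = subst (_≤ x + _) (ℚ.+-identityʳ x) (ℚ.+-monoʳ-≤ x y≥0)

term≤Σℚ : ∀ {m} {f : Fin m → ℚ} → (∀ j → 0ℚ ≤ f j) → ∀ j → f j ≤ Σℚ f
term≤Σℚ         f≥0 zero    = x≤x+nonNeg (Σℚ-nonNeg (f≥0 ∘ suc))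
term≤Σℚ {f = f} f≥0 (suc j) =
  subst (_≤ Σℚ f) (ℚ.+-identityˡ (f (suc j))) (ℚ.+-mono-≤ (f≥0 zero) (term≤Σℚ (f≥0 ∘ suc) j))

pair≤Σℚ : ∀ {m} {f : Fin m → ℚ} → (∀ j → 0ℚ ≤ f j) → ∀ i j → i ≢ j → f i + f j ≤ Σℚ f
pair≤Σℚ         f≥0 zero    zero    i≢j = ⊥-elim (i≢j refl)
pair≤Σℚ {f = f} f≥0 zero    (suc j) _   = ℚ.+-monoʳ-≤ (f zero) (term≤Σℚ (f≥0 ∘ suc) j)
pair≤Σℚ {f = f} f≥0 (suc i) zero    _   =
  subst (_≤ Σℚ f) (ℚ.+-comm (f zero) (f (suc i))) (ℚ.+-monoʳ-≤ (f zero) (term≤Σℚ (f≥0 ∘ suc) i))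
pair≤Σℚ {f = f} f≥0 (suc i) (suc j) i≢j =
  subst (_≤ Σℚ f) (ℚ.+-identityˡ _)
    (ℚ.+-mono-≤ (f≥0 zero) (pair≤Σℚ (f≥0 ∘ suc) i j (i≢j ∘ cong suc)))

b2q-nonNeg : ∀ b → 0ℚ ≤ b2q b
b2q-nonNeg true  = toWitness {a? = 0ℚ ≤? 1ℚ} tt
b2q-nonNeg false = ℚ.≤-refl

b2q-∧ : ∀ a b → b2q a * b2q b ≡ b2q (a ∧ b)
b2q-∧ true  true  = refl
b2q-∧ true  false = refl
b2q-∧ false true  = refl
b2q-∧ false false = refl

b2q-*-nonNeg : ∀ a b → 0ℚ ≤ b2q a * b2q b
b2q-*-nonNeg a b = subst (0ℚ ≤_) (sym (b2q-∧ a b)) (b2q-nonNeg (a ∧ b))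

1+1≰1 : ¬ (1ℚ + 1ℚ ≤ 1ℚ)
1+1≰1 = toWitnessFalse {a? = 1ℚ + 1ℚ ≤? 1ℚ} tt

Σℚ-b2q-≤1 : ∀ {m} (b : Fin m → Bool) → (∀ i j → i ≢ j → b i ≡ true → b j ≡ false) →
            Σℚ (b2q ∘ b) ≤ 1ℚ
Σℚ-b2q-≤1 {zero}  b exclusive = b2q-nonNeg true
Σℚ-b2q-≤1 {suc m} b exclusive with b zero in b₀
... | true  = ℚ.≤-reflexive (trans (cong (1ℚ +_) rest≡0) (ℚ.+-identityʳ 1ℚ))
  where
  rest≡0 : Σℚ (b2q ∘ b ∘ suc) ≡ 0ℚ
  rest≡0 = Σℚ-zero (λ j → cong b2q (exclusive zero (suc j) (λ ()) b₀))
... | false = subst (_≤ 1ℚ) (sym (ℚ.+-identityˡ _))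
                (Σℚ-b2q-≤1 (b ∘ suc) (λ i j i≢j → exclusive (suc i) (suc j) (i≢j ∘ suc-injective)))

b2q-pair-minus-zero-≰1 : ∀ {a b s} → a ≡ true → b ≡ true → s ≡ 0ℚ → ¬ ((b2q a + b2q b) - s ≤ 1ℚ)
b2q-pair-minus-zero-≰1 refl refl refl = toWitnessFalse {a? = (1ℚ + 1ℚ) - 0ℚ ≤? 1ℚ} tt

p≤q+r⇒p-r≤q : ∀ {p q r} → p ≤ q + r → p - r ≤ q
p≤q+r⇒p-r≤q {p} {q} {r} p≤q+r = ℚ.≤-trans (ℚ.+-monoˡ-≤ (- r) p≤q+r) (ℚ.≤-reflexive q+r-r≡q)
  where
  q+r-r≡q : (q + r) - r ≡ q
  q+r-r≡q = trans (ℚ.+-assoc q r (- r)) (trans (cong (q +_) (ℚ.+-inverseʳ r)) (ℚ.+-identityʳ q))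

b2q-pair-minus-≤1 : ∀ a b {s} → 0ℚ ≤ s → (a ≡ true → b ≡ true → 1ℚ ≤ s) → (b2q a + b2q b) - s ≤ 1ℚ
b2q-pair-minus-≤1 a b {s} s≥0 s≥1 = p≤q+r⇒p-r≤q {q = 1ℚ} {r = s} (pair≤1+s a b s≥1)
  where
  1≤1+s : 1ℚ ≤ 1ℚ + s
  1≤1+s = x≤x+nonNeg s≥0
  pair≤1+s : ∀ a b → (a ≡ true → b ≡ true → 1ℚ ≤ s) → b2q a + b2q b ≤ 1ℚ + s
  pair≤1+s true  true  s≥1 = ℚ.+-monoʳ-≤ 1ℚ (s≥1 refl refl)
  pair≤1+s true  false _   = ℚ.≤-trans (toWitness {a? = 1ℚ + 0ℚ ≤? 1ℚ} tt) 1≤1+s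
  pair≤1+s false true  _   = ℚ.≤-trans (toWitness {a? = 0ℚ + 1ℚ ≤? 1ℚ} tt) 1≤1+s
  pair≤1+s false false _   = ℚ.≤-trans (toWitness {a? = 0ℚ + 0ℚ ≤? 1ℚ} tt) 1≤1+s

module _ {n : ℕ} where

  _⊆_ : Subset n → Subset n → Set
  A ⊆ B = ∀ z → A z ≡ true → B z ≡ true

  ⊆-trans : ∀ {A B C : Subset n} → A ⊆ B → B ⊆ C → A ⊆ C
  ⊆-trans A⊆B B⊆C z = B⊆C z ∘ A⊆B z

  ⊆-false : ∀ {A B : Subset n} → A ⊆ B → ∀ {z} → B z ≡ false → A z ≡ false
  ⊆-false {A} A⊆B {z} Bz≡false with A z in Az
  ... | false = refl
  ... | true  = trans (sym (A⊆B z Az)) Bz≡false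

  ∁ : Subset n → Subset n
  ∁ A z = not (A z)

  ∁-antitone : ∀ {A B : Subset n} → A ⊆ B → ∁ B ⊆ ∁ A
  ∁-antitone A⊆B z ∁Bz = cong not (⊆-false A⊆B (trans (sym (not-involutive _)) (cong not ∁Bz)))

  remove : Fin n → Subset n → Subset n
  remove z A y = if does (y ≟ z) then false else A y

  remove-self : ∀ z A → remove z A z ≡ false
  remove-self z A with z ≟ z
  ... | yes _   = refl
  ... | no z≢z = ⊥-elim (z≢z refl)

  remove-other : ∀ {z y} A → y ≢ z → remove z A y ≡ A y
  remove-other {z} {y} A y≢z with y ≟ z
  ... | yes y≡z = ⊥-elim (y≢z y≡z)
  ... | no _    = refl

  remove-⊆ : ∀ z A → remove z A ⊆ A
  remove-⊆ z A y with y ≟ z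
  ... | no _ = λ Ay → Ay

  ⊆-remove : ∀ {A B : Subset n} {z} → A ⊆ B → A z ≡ false → A ⊆ remove z B
  ⊆-remove {A} {B} {z} A⊆B Az≡false y Ay with y ≟ z
  ... | no _     = A⊆B y Ay
  ... | yes refl with trans (sym Ay) Az≡false
  ...   | ()

size : ∀ {n} → Subset n → ℕ
size {zero}  A = 0
size {suc n} A = (if A zero then 1 else 0) ℕ.+ size (A ∘ suc)

size-remove : ∀ {n} (z : Fin n) A → A z ≡ true → size (remove z A) ℕ.< size A
size-remove zero    A Az rewrite Az = ℕ.≤-refl
size-remove (suc z) A Az with A zero
... | true  = s≤s (size-remove z (A ∘ suc) Az)
... | false = size-remove z (A ∘ suc) Az

module _ {n : ℕ} (G : Graph n) where

  walk-start : ∀ {A u v} → Walk G A u v → A u ≡ true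
  walk-start (here Au)     = Au
  walk-start (step Au _ _) = Au

  walk-mono : ∀ {A B} → A ⊆ B → ∀ {u v} → Walk G A u v → Walk G B u v
  walk-mono A⊆B (here Au)         = here (A⊆B _ Au)
  walk-mono A⊆B (step Au uv walk) = step (A⊆B _ Au) uv (walk-mono A⊆B walk)

  walk-avoiding⊎after-last-visit : ∀ {A x v} z → Walk G A x v → v ≢ z →
    Walk G (remove z A) x v ⊎ (∃ λ s → adj G z s ≡ true × Walk G (remove z A) s v)
  walk-avoiding⊎after-last-visit {A} z (here Ax) x≢z = inj₁ (here (trans (remove-other A x≢z) Ax))
  walk-avoiding⊎after-last-visit {A} {x} z (step {v = y} Ax xy walk) v≢z
    with walk-avoiding⊎after-last-visit z walk v≢z
  ... | inj₂ tail = inj₂ tail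
  ... | inj₁ walk′ with x ≟ z
  ...   | yes refl = inj₂ (y , xy , walk′)
  ...   | no x≢z   = inj₁ (step (trans (remove-other A x≢z) Ax) xy walk′)

  walk-first-step : ∀ {A u v} → u ≢ v → Walk G A u v →
    ∃ λ s → adj G u s ≡ true × Walk G (remove u A) s v
  walk-first-step {A} {u} u≢v walk with walk-avoiding⊎after-last-visit u walk (u≢v ∘ sym)
  ... | inj₂ tail  = tail
  ... | inj₁ walk′ with trans (sym (walk-start walk′)) (remove-self u A)
  ...   | ()

  walk?-acc : ∀ A → Acc ℕ._<_ (size A) → ∀ u v → Dec (Walk G A u v)
  walk?-acc A (acc rec) u v with A u ≟ᵇ true
  ... | no u∉A = no (u∉A ∘ walk-start)
  ... | yes u∈A with u ≟ v
  ...   | yes refl = yes (here u∈A)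
  ...   | no u≢v  =
    map′ (λ (s , us , walk) → step u∈A us (walk-mono (remove-⊆ u A) walk))
         (walk-first-step u≢v)
         (any? λ s → (adj G u s ≟ᵇ true)
                     ×-dec walk?-acc (remove u A) (rec (size-remove u A u∈A)) s v)

  walk? : ∀ A u v → Dec (Walk G A u v)
  walk? A = walk?-acc A (<-wellFounded (size A))

  walk-meets⊎avoids : ∀ {A} S {u v} → Walk G A u v →
    (∃ λ z → A z ≡ true × S z ≡ true) ⊎ Walk G (∁ S) u v
  walk-meets⊎avoids S {u} walk with S u in Su
  ... | true = inj₁ (u , walk-start walk , Su)
  walk-meets⊎avoids S (here _)      | false = inj₂ (here (cong not Su))
  walk-meets⊎avoids S (step _ uv walk) | false with walk-meets⊎avoids S walk
  ...   | inj₁ meet   = inj₁ meet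
  ...   | inj₂ avoid  = inj₂ (step (cong not Su) uv avoid)

  separator-mono : ∀ {u v S T} → S ⊆ T → T u ≡ false → T v ≡ false →
    IsSeparator G u v S → IsSeparator G u v T
  separator-mono S⊆T Tu Tv (_ , _ , ¬walk) = Tu , Tv , ¬walk ∘ walk-mono (∁-antitone S⊆T)

  separator? : ∀ u v S → Dec (IsSeparator G u v S)
  separator? u v S = (S u ≟ᵇ false) ×-dec (S v ≟ᵇ false) ×-dec ¬? (walk? (∁ S) u v)

  -- Once no single vertex can be dropped, no proper subset separates either, since
  -- separators are closed upwards.
  minimal-separator-⊆-acc : ∀ {u v} S → IsSeparator G u v S → Acc ℕ._<_ (size S) →
    Σ (Subset n) λ R → R ⊆ S × IsMinimalSeparator G u v R
  minimal-separator-⊆-acc {u} {v} S sep@(Su , Sv , _) (acc rec)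
    with any? (λ z → (S z ≟ᵇ true) ×-dec separator? u v (remove z S))
  ... | yes (z , z∈S , sep′) with minimal-separator-⊆-acc (remove z S) sep′ (rec (size-remove z S z∈S))
  ...   | R , R⊆ , minimal = R , ⊆-trans R⊆ (remove-⊆ z S) , minimal
  minimal-separator-⊆-acc {u} {v} S sep@(Su , Sv , _) (acc rec)
      | no undroppable = S , (λ _ Sz → Sz) , sep , minimal
    where
    minimal : ∀ S′ → ProperSubset S′ S → ¬ IsSeparator G u v S′
    minimal S′ (S′⊆S , z , z∈S , z∉S′) sep′ =
      undroppable (z , z∈S , separator-mono (⊆-remove S′⊆S z∉S′)
                               (⊆-false (remove-⊆ z S) Su) (⊆-false (remove-⊆ z S) Sv) sep′)

  disconnected⇒minimal-separator-⊆∁ : ∀ {A u v} → A u ≡ true → A v ≡ true → ¬ Walk G A u v →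
    Σ (Subset n) λ R → R ⊆ ∁ A × IsMinimalSeparator G u v R
  disconnected⇒minimal-separator-⊆∁ {A} Au Av ¬walk =
    minimal-separator-⊆-acc (∁ A) (cong not Au , cong not Av , ¬walk ∘ walk-mono ∁∁A⊆A)
      (<-wellFounded _)
    where
    ∁∁A⊆A : ∁ (∁ A) ⊆ A
    ∁∁A⊆A z = trans (sym (not-involutive (A z)))

module _ {n k : ℕ} (G : Graph n) (w : Fin n → ℚ) where

  weighted-column≡wt : (A : Subset n) → Σℚ (λ v → w v * b2q (A v)) ≡ wt w A
  weighted-column≡wt A = Σℚ-cong (λ v → ℚ.*-comm (w v) (b2q (A v)))

  feasible⇒connected-subpartition : ∀ x → Feasible G w x → IsConnSubpartition {k = k} G w (flip x)
  feasible⇒connected-subpartition x (ordered , atMostOne , separatorBound) =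
    disjoint , connected , weightOrdered
    where
    disjoint : ∀ i j → i ≢ j → ∀ v → x v i ≡ true → x v j ≡ false
    disjoint i j i≢j v xvi with x v j in xvj
    ... | false = refl
    ... | true  = ⊥-elim (1+1≰1 (ℚ.≤-trans 1+1≤row (atMostOne v)))
      where
      1+1≤row : 1ℚ + 1ℚ ≤ Σℚ (b2q ∘ x v)
      1+1≤row = subst₂ (λ a b → b2q a + b2q b ≤ Σℚ (b2q ∘ x v)) xvi xvj
                  (pair≤Σℚ (b2q-nonNeg ∘ x v) i j i≢j)

    weightOrdered : ∀ i j → Consecutive i j → wt w (flip x i) ≤ wt w (flip x j)
    weightOrdered i j ij = subst₂ _≤_ (weighted-column≡wt (flip x i)) (weighted-column≡wt (flip x j))
                             (ordered i j ij)

    connected : ∀ i → InducesConnected G (flip x i)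
    connected i u v xui xvi with walk? G (flip x i) u v
    ... | yes walk = walk
    ... | no ¬walk with adj G u v in uv
    ...   | true  = ⊥-elim (¬walk (step xui uv (here xvi)))
    ...   | false with disconnected⇒minimal-separator-⊆∁ G xui xvi ¬walk
    ...     | R , R⊆∁ , minimal =
      ⊥-elim (b2q-pair-minus-zero-≰1 xui xvi (Σℚ-zero R-misses-column)
                (separatorBound u v u≢v uv R minimal i))
      where
      u≢v : u ≢ v
      u≢v refl = ¬walk (here xui)
      R-misses-column : ∀ z → b2q (R z) * b2q (x z i) ≡ 0ℚ
      R-misses-column z = trans (b2q-∧ (R z) (x z i)) (cong b2q (R-misses z))
        where
        R-misses : ∀ z → R z ∧ x z i ≡ false
        R-misses z with R z in Rz
        ... | false = refl
        ... | true  = trans (sym (not-involutive _)) (cong not (R⊆∁ z Rz))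

  connected-subpartition⇒feasible : ∀ V → IsConnSubpartition {k = k} G w V → Feasible G w (flip V)
  connected-subpartition⇒feasible V (disjoint , connected , weightOrdered) =
    ordered , atMostOne , separatorBound
    where
    ordered : ∀ i j → Consecutive i j →
      Σℚ (λ v → w v * embed (flip V) v i) ≤ Σℚ (λ v → w v * embed (flip V) v j)
    ordered i j ij = subst₂ _≤_ (sym (weighted-column≡wt (V i))) (sym (weighted-column≡wt (V j)))
                       (weightOrdered i j ij)

    atMostOne : ∀ v → Σℚ (λ i → embed (flip V) v i) ≤ 1ℚ
    atMostOne v = Σℚ-b2q-≤1 (flip V v) (λ i j i≢j → disjoint i j i≢j v)

    separatorBound : ∀ u v → u ≢ v → adj G u v ≡ false → ∀ S → IsMinimalSeparator G u v S → ∀ i →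
      (embed (flip V) u i + embed (flip V) v i) - Σℚ (λ z → b2q (S z) * embed (flip V) z i) ≤ 1ℚ
    separatorBound u v _ _ S ((_ , _ , ¬avoid) , _) i =
      b2q-pair-minus-≤1 (V i u) (V i v) (Σℚ-nonNeg (λ z → b2q-*-nonNeg (S z) (V i z))) S-meets-column
      where
      S-meets-column : V i u ≡ true → V i v ≡ true → 1ℚ ≤ Σℚ (λ z → b2q (S z) * b2q (V i z))
      S-meets-column Viu Viv with walk-meets⊎avoids G S (connected i u v Viu Viv)
      ... | inj₂ avoid         = ⊥-elim (¬avoid avoid)
      ... | inj₁ (z , Viz , Sz) =
        subst (_≤ _) (trans (b2q-∧ (S z) (V i z)) (cong₂ (λ a b → b2q (a ∧ b)) Sz Viz))
          (term≤Σℚ (λ z → b2q-*-nonNeg (S z) (V i z)) z)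

  feasible-point⇒subpartition-point : ∀ (y : QVec n k) →
    (Σ (Fin n → Fin k → Bool) λ x → Feasible G w x × (∀ v i → y v i ≡ embed x v i)) →
    Σ (Fin k → Subset n) λ V → IsConnSubpartition G w V × (∀ v i → y v i ≡ ξ V v i)
  feasible-point⇒subpartition-point _ (x , feasible , y≡x) =
    flip x , feasible⇒connected-subpartition x feasible , y≡x

  subpartition-point⇒feasible-point : ∀ (y : QVec n k) →
    (Σ (Fin k → Subset n) λ V → IsConnSubpartition G w V × (∀ v i → y v i ≡ ξ V v i)) →
    Σ (Fin n → Fin k → Bool) λ x → Feasible G w x × (∀ v i → y v i ≡ embed x v i)
  subpartition-point⇒feasible-point _ (V , partition , y≡V) =
    flip V , connected-subpartition⇒feasible V partition , y≡V

Conv-mono : ∀ {n k} {P Q : QVec n k → Set} → (∀ y → P y → Q y) → ∀ {y} → Conv P y → Conv Q y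
Conv-mono P⇒Q (m , p , λs , Pp , λs≥0 , Σλs≡1 , y≡Σλsp) =
  m , p , λs , (λ j → P⇒Q (p j) (Pp j)) , λs≥0 , Σλs≡1 , y≡Σλsp

mainTheorem1 : (k : ℕ) → k ≥ 1 → (n : ℕ) → (G : Graph n) → Connected G →
    (w : Fin n → ℚ) → (∀ v → 0ℚ < w v) →
    (y : QVec n k) → (Pk G w y → SubpartitionPolytope G w y) × (SubpartitionPolytope G w y → Pk G w y)
mainTheorem1 k _ n G _ w _ y =
  Conv-mono (feasible-point⇒subpartition-point G w) , Conv-mono (subpartition-point⇒feasible-point G w)
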